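{- Let $\mathcal{T}$ be a collection of binary phylogenetic $X$-trees, let $S$ be any partial cherry picking sequence, and let $\{x,y\}$ be a non-trivial cherry of $\mathcal{T}/S$. Then $k'(\mathcal{T},S\circ\langle (x,y)\rangle)=k'(\mathcal{T},S)+1$.
   Context: A binary phylogenetic $X'$-tree is a rooted tree whose root has out-degree 2, whose internal non-root nodes have in-degree 1 and out-degree 2, and whose leaves are bijectively labelled by $X'$ (or a single node if $|X'|=1$). A pair $\{x,y\}$ is a cherry of a tree if leaves $x,y$ are siblings. For a set of trees $\mathcal{T}$, $\{x,y\}$ is a cherry of $\mathcal{T}$ if it is a cherry of at least one tree in $\mathcal{T}$; it is trivial if it is a cherry of every tree in $\mathcal{T}$ containing both $x$ and $y$, and non-trivial otherwise. A partial cherry picking sequence is a sequence $S=\langle (x_1,y_1),\dots,(x_r,y_r)\rangle$ of pairs of elements of $X$, with $|S|=r$; $\circ$ denotes concatenation. Applying $S$ to a tree $T$: $T^{(0)}=T$, and for $j\le r$, if $\{x_j,y_j\}$ is a cherry of $T^{(j-1)}$ then $T^{(j)}$ is obtained by deleting leaf $x_j$ and suppressing the parent of $y_j$, otherwise $T^{(j)}=T^{(j-1)}$; $T/S=T^{(r)}$, $\mathcal{T}/S=\{T/S:T\in\mathcal{T}\}$. Define $n'(\mathcal{T},S)=|\{x\in X: x \text{ is a leaf of some tree in } \mathcal{T}/S\}|$ and $k'(\mathcal{T},S)=|S|-|X|+n'(\mathcal{T},S)$. -}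

module Defs where

open import Data.Nat using (ℕ; _≟_; _≡ᵇ_)
open import Data.Bool using (Bool; true; false; _∧_; _∨_; if_then_else_)
open import Data.List using (List; []; _∷_; _++_; map; foldl; length; filter; [_])
open import Data.List.Relation.Unary.Any using (Any; any?)
open import Data.List.Relation.Unary.All using (All)
open import Data.List.Relation.Unary.Unique.Propositional using (Unique)
open import Data.List.Relation.Binary.Permutation.Propositional using (_↭_)
open import Data.List.Membership.Propositional using (_∈_)
open import Data.List.Membership.DecPropositional _≟_ using (_∈?_)
open import Data.Product using (_×_; _,_; proj₁; proj₂)
open import Data.Integer using (ℤ; +_; _+_; _-_)
open import Relation.Nullary using (¬_)

data Tree : Set where
  leaf : ℕ → Tree
  node : Tree → Tree → Tree

leaves : Tree → List ℕ
leaves (leaf a)   = a ∷ []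
leaves (node l r) = leaves l ++ leaves r

-- T is a binary phylogenetic X-tree: its leaves are bijectively labelled by X
-- (X is given as a duplicate-free list).
PhyloTree : List ℕ → Tree → Set
PhyloTree X T = leaves T ↭ X

data CherryOf (x y : ℕ) : Tree → Set where
  here₁ : CherryOf x y (node (leaf x) (leaf y))
  here₂ : CherryOf x y (node (leaf y) (leaf x))
  left  : ∀ {l r} → CherryOf x y l → CherryOf x y (node l r)
  right : ∀ {l r} → CherryOf x y r → CherryOf x y (node l r)

CherryOfSet : ℕ → ℕ → List Tree → Set
CherryOfSet x y Ts = Any (CherryOf x y) Ts

TrivialCherry : ℕ → ℕ → List Tree → Set
TrivialCherry x y Ts =
  CherryOfSet x y Ts × All (λ T → x ∈ leaves T → y ∈ leaves T → CherryOf x y T) Ts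

NonTrivialCherry : ℕ → ℕ → List Tree → Set
NonTrivialCherry x y Ts = CherryOfSet x y Ts × ¬ TrivialCherry x y Ts

isPair : ℕ → ℕ → Tree → Tree → Bool
isPair x y (leaf a) (leaf b) = ((a ≡ᵇ x) ∧ (b ≡ᵇ y)) ∨ ((a ≡ᵇ y) ∧ (b ≡ᵇ x))
isPair x y _ _ = false

-- Picking (x,y) in T: if {x,y} is a cherry, delete leaf x and suppress the
-- parent of y (i.e. replace the cherry subtree by the leaf y); otherwise T
-- is unchanged (no subtree matches).
pick : ℕ → ℕ → Tree → Tree
pick x y (leaf a)   = leaf a
pick x y (node l r) =
  if isPair x y l r then leaf y else node (pick x y l) (pick x y r)

CPS : Set
CPS = List (ℕ × ℕ)

_/ₜ_ : Tree → CPS → Tree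
T /ₜ S = foldl (λ U p → pick (proj₁ p) (proj₂ p) U) T S

_/ₛ_ : List Tree → CPS → List Tree
Ts /ₛ S = map (λ T → T /ₜ S) Ts

n′ : List ℕ → List Tree → CPS → ℕ
n′ X Ts S = length (filter (λ z → any? (λ T → z ∈? leaves T) (Ts /ₛ S)) X)

k′ : List ℕ → List Tree → CPS → ℤ
k′ X Ts S = (+ length S) - (+ length X) + (+ n′ X Ts S)

module Submission where

-- Picking (x, y) deletes no leaf other than x, and deletes x from a tree only
-- when {x, y} is a cherry of that tree. Were x deleted from every tree of 𝒯/S,
-- {x, y} would be a cherry of every tree containing x, i.e. trivial. So for a
-- non-trivial cherry the set of surviving leaves, and hence n′, is unchanged,
-- while |S| grows by one.

open import Defs
open import Data.Nat using (ℕ; _≟_; _≡ᵇ_)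
open import Data.Nat.Properties using (≡ᵇ⇒≡)
open import Data.Bool using (true; false; _∧_)
open import Data.Bool.Properties using (T-≡; T-∧; T-∨)
open import Data.List using (List; _++_; [_]; map; length)
open import Data.List.Properties using (foldl-++; length-++; map-cong; map-∘; filter-≐)
open import Data.List.Relation.Unary.All as All using (All)
open import Data.List.Relation.Unary.All.Properties using (¬Any⇒All¬)
open import Data.List.Relation.Unary.Any as Any using (Any; here; there; any?)
import Data.List.Relation.Unary.Any.Properties as Any
open import Data.List.Relation.Unary.Unique.Propositional using (Unique)
open import Data.List.Membership.Propositional using (_∈_; _∉_)
open import Data.List.Membership.Propositional.Properties using (∈-++⁺ˡ; ∈-++⁺ʳ; ∈-++⁻)
open import Data.List.Membership.DecPropositional _≟_ using (_∈?_)
open import Data.Product using (_×_; _,_; proj₁; proj₂)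
open import Data.Sum using (inj₁; inj₂)
open import Data.Integer using (+_; _+_; _-_)
open import Data.Integer.Tactic.RingSolver using (solve-∀)
open import Function using (_∘_)
open import Function.Bundles using (Equivalence)
open import Relation.Nullary using (¬_; yes; no; contradiction)
open import Relation.Nullary.Decidable using (decidable-stable)
open import Relation.Unary using (_≐_)
open import Relation.Binary.PropositionalEquality
  using (_≡_; _≢_; refl; sym; trans; cong; cong₂; module ≡-Reasoning)

data CherryNode (x y : ℕ) : Tree → Tree → Set where
  xy : CherryNode x y (leaf x) (leaf y)
  yx : CherryNode x y (leaf y) (leaf x)

isPair⇒CherryNode : ∀ {x y} l r → isPair x y l r ≡ true → CherryNode x y l r
isPair⇒CherryNode {x} {y} (leaf a) (leaf b) eq
  with T-∨ {(a ≡ᵇ x) ∧ (b ≡ᵇ y)} .Equivalence.to (T-≡ .Equivalence.from eq)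
... | inj₁ a≡x∧b≡y with T-∧ .Equivalence.to a≡x∧b≡y
...   | a≡x , b≡y with ≡ᵇ⇒≡ a x a≡x | ≡ᵇ⇒≡ b y b≡y
...     | refl | refl = xy
isPair⇒CherryNode {x} {y} (leaf a) (leaf b) eq
    | inj₂ a≡y∧b≡x with T-∧ .Equivalence.to a≡y∧b≡x
...   | a≡y , b≡x with ≡ᵇ⇒≡ a y a≡y | ≡ᵇ⇒≡ b x b≡x
...     | refl | refl = yx

module _ {x y : ℕ} where

  ∈-pick⁻ : ∀ {z} U → z ∈ leaves (pick x y U) → z ∈ leaves U
  ∈-pick⁻ (leaf a) z∈ = z∈
  ∈-pick⁻ (node l r) z∈ with isPair x y l r in eq
  ... | true with isPair⇒CherryNode l r eq | z∈
  ...   | xy | here refl = there (here refl)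
  ...   | yx | here refl = here refl
  ∈-pick⁻ (node l r) z∈ | false with ∈-++⁻ (leaves (pick x y l)) z∈
  ... | inj₁ z∈l = ∈-++⁺ˡ (∈-pick⁻ l z∈l)
  ... | inj₂ z∈r = ∈-++⁺ʳ (leaves l) (∈-pick⁻ r z∈r)

  ∈-pick⁺ : ∀ {z} → z ≢ x → ∀ U → z ∈ leaves U → z ∈ leaves (pick x y U)
  ∈-pick⁺ z≢x (leaf a) z∈ = z∈
  ∈-pick⁺ z≢x (node l r) z∈ with isPair x y l r in eq
  ... | true with isPair⇒CherryNode l r eq | z∈
  ...   | xy | here refl = contradiction refl z≢x
  ...   | xy | there (here refl) = here refl
  ...   | yx | here refl = here refl
  ...   | yx | there (here refl) = contradiction refl z≢x
  ∈-pick⁺ z≢x (node l r) z∈ | false with ∈-++⁻ (leaves l) z∈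
  ... | inj₁ z∈l = ∈-++⁺ˡ (∈-pick⁺ z≢x l z∈l)
  ... | inj₂ z∈r = ∈-++⁺ʳ (leaves (pick x y l)) (∈-pick⁺ z≢x r z∈r)

  ∉-pick⇒CherryOf : ∀ U → x ∈ leaves U → x ∉ leaves (pick x y U) → CherryOf x y U
  ∉-pick⇒CherryOf (leaf a) x∈ x∉ = contradiction x∈ x∉
  ∉-pick⇒CherryOf (node l r) x∈ x∉ with isPair x y l r in eq
  ... | true with isPair⇒CherryNode l r eq
  ...   | xy = here₁
  ...   | yx = here₂
  ∉-pick⇒CherryOf (node l r) x∈ x∉ | false with ∈-++⁻ (leaves l) x∈
  ... | inj₁ x∈l = left (∉-pick⇒CherryOf l x∈l (x∉ ∘ ∈-++⁺ˡ))
  ... | inj₂ x∈r = right (∉-pick⇒CherryOf r x∈r (x∉ ∘ ∈-++⁺ʳ (leaves (pick x y l))))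

Occurs : List Tree → ℕ → Set
Occurs Us z = Any (λ U → z ∈ leaves U) Us

module _ {x y : ℕ} where

  nonTrivial⇒Occurs-pick : ∀ {Us} → NonTrivialCherry x y Us → Occurs (map (pick x y) Us) x
  nonTrivial⇒Occurs-pick {Us} (cherry , nonTrivial) =
    decidable-stable (any? (λ U → x ∈? leaves U) (map (pick x y) Us)) (nonTrivial ∘ trivial)
    where
    trivial : ¬ Occurs (map (pick x y) Us) x → TrivialCherry x y Us
    trivial x∉all = cherry , All.map (λ {U} x∉ x∈ _ → ∉-pick⇒CherryOf U x∈ x∉)
                                     (¬Any⇒All¬ Us (x∉all ∘ Any.map⁺))

  Occurs-pick : ∀ {Us} → NonTrivialCherry x y Us → Occurs Us ≐ Occurs (map (pick x y) Us)
  Occurs-pick {Us} nonTrivial = to , from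
    where
    to : ∀ {z} → Occurs Us z → Occurs (map (pick x y) Us) z
    to {z} z∈Us with z ≟ x
    ... | yes refl = nonTrivial⇒Occurs-pick nonTrivial
    ... | no z≢x = Any.map⁺ (Any.map (λ {U} → ∈-pick⁺ {x} {y} z≢x U) z∈Us)

    from : ∀ {z} → Occurs (map (pick x y) Us) z → Occurs Us z
    from = Any.map (λ {U} → ∈-pick⁻ {x} {y} U) ∘ Any.map⁻

/ₛ-∷ʳ : ∀ Ts S x y → Ts /ₛ (S ++ [ (x , y) ]) ≡ map (pick x y) (Ts /ₛ S)
/ₛ-∷ʳ Ts S x y = trans (map-cong (λ U → foldl-++ _ U S [ (x , y) ]) Ts) (map-∘ Ts)

n′-pick-nonTrivial : ∀ X Ts S {x y} → NonTrivialCherry x y (Ts /ₛ S) →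
                     n′ X Ts (S ++ [ (x , y) ]) ≡ n′ X Ts S
n′-pick-nonTrivial X Ts S {x} {y} nonTrivial rewrite /ₛ-∷ʳ Ts S x y =
  cong length (sym (filter-≐ _ _ (Occurs-pick nonTrivial) X))

lemma12 : (X : List ℕ) → Unique X → (Ts : List Tree) → All (PhyloTree X) Ts →
          (S : CPS) → All (λ p → proj₁ p ∈ X × proj₂ p ∈ X) S →
          (x y : ℕ) → NonTrivialCherry x y (Ts /ₛ S) →
          k′ X Ts (S ++ [ (x , y) ]) ≡ k′ X Ts S + + 1
lemma12 X _ Ts _ S _ x y nonTrivial = begin
  k′ X Ts (S ++ [ (x , y) ])
    ≡⟨ cong₂ (λ s n → + s - + length X + + n)
             (length-++ S) (n′-pick-nonTrivial X Ts S nonTrivial) ⟩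
  + length S + + 1 - + length X + + n′ X Ts S
    ≡⟨ +1-shift (+ length S) (+ length X) (+ n′ X Ts S) ⟩
  k′ X Ts S + + 1 ∎
  where
  open ≡-Reasoning
  +1-shift : ∀ s l n → s + + 1 - l + n ≡ s - l + n + + 1
  +1-shift = solve-∀
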